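{- Each entry of an extreme point of $\Omega_n^{t\&h}$ equals one of $0,\frac14,\frac12,\frac34,1$, and thus an extreme point of $\Omega_n^{t\&h}$ has at most four nonzero entries in each row and each column.
   Context: For an $n\times n$ matrix $A=[a_{ij}]$, $A^t$ is the transpose and the Hankel transpose $A^h$ has $(i,j)$ entry $a_{n+1-j,n+1-i}$; $A$ is Hankel-symmetric if $A^h=A$. $\Omega_n^{t\&h}$ is the convex polytope of all $n\times n$ doubly stochastic matrices (nonnegative, all row and column sums $1$) that are both symmetric and Hankel-symmetric.
   Formalization: The polytope $\Omega_n^{t\&h}$ is taken over the rationals: its matrices have rational entries, and extremality is tested against convex combinations with rational weights of rational matrices. -}

module Defs where

open import Data.Nat using (ℕ; zero; suc)
open import Data.Fin using (Fin; zero; suc; opposite)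
open import Data.Integer using (+_)
open import Data.Rational using (ℚ; 0ℚ; 1ℚ; _+_; _*_; _-_; _/_; _≤_; _<_)
open import Data.Rational.Properties using (_≟_)
open import Data.Product using (_×_)
open import Relation.Nullary using (yes; no)
open import Relation.Binary.PropositionalEquality using (_≡_)

Matrix : ℕ → Set
Matrix n = Fin n → Fin n → ℚ

sumℚ : ∀ {n} → (Fin n → ℚ) → ℚ
sumℚ {zero}  f = 0ℚ
sumℚ {suc n} f = f zero + sumℚ (λ i → f (suc i))

transpose : ∀ {n} → Matrix n → Matrix n
transpose A i j = A j i

-- Hankel transpose: (A^h)_{ij} = a_{n+1-j, n+1-i}  (1-indexed);
-- with 0-indexing, n+1-k becomes opposite k = n-1-k.
hankelTranspose : ∀ {n} → Matrix n → Matrix n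
hankelTranspose A i j = A (opposite j) (opposite i)

IsDoublyStochastic : ∀ {n} → Matrix n → Set
IsDoublyStochastic {n} A =
  (∀ i j → 0ℚ ≤ A i j) ×
  (∀ i → sumℚ (λ j → A i j) ≡ 1ℚ) ×
  (∀ j → sumℚ (λ i → A i j) ≡ 1ℚ)

IsSymmetric : ∀ {n} → Matrix n → Set
IsSymmetric A = ∀ i j → transpose A i j ≡ A i j

IsHankelSymmetric : ∀ {n} → Matrix n → Set
IsHankelSymmetric A = ∀ i j → hankelTranspose A i j ≡ A i j

InΩth : ∀ {n} → Matrix n → Set
InΩth A = IsDoublyStochastic A × IsSymmetric A × IsHankelSymmetric A

convComb : ∀ {n} → ℚ → Matrix n → Matrix n → Matrix n
convComb l B C i j = l * B i j + (1ℚ - l) * C i j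

IsExtremePointΩth : ∀ {n} → Matrix n → Set
IsExtremePointΩth {n} A =
  InΩth A ×
  (∀ (B C : Matrix n) (l : ℚ) → InΩth B → InΩth C → 0ℚ < l → l < 1ℚ →
     (∀ i j → A i j ≡ convComb l B C i j) →
     (∀ i j → B i j ≡ A i j) × (∀ i j → C i j ≡ A i j))

countNonzero : ∀ {n} → (Fin n → ℚ) → ℕ
countNonzero {zero}  f = zero
countNonzero {suc n} f with f zero ≟ 0ℚ
... | yes _ = countNonzero (λ i → f (suc i))
... | no  _ = suc (countNonzero (λ i → f (suc i)))

¼ ¾ : ℚ
¼ = + 1 / 4
¾ = + 3 / 4

{-# OPTIONS --safe #-}
module Submission where

-- The support of a doubly stochastic matrix satisfies Hall's condition, so it contains the graph of
-- a permutation π (Hall's theorem, by Rado's argument: at a vertex with two neighbours one of the two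
-- edges can be deleted without breaking Hall's condition).  With P the permutation matrix of π,
-- Q = ¼ (P + Pᵗ + Pʰ + Pᵗʰ) lies in Ω_n^{t&h}, has entries in {0, ¼, ½, ¾, 1}, and vanishes wherever
-- the extreme point A does.  Hence A ± δ (Q − A) ∈ Ω_n^{t&h} for a small δ > 0; A is their midpoint,
-- so extremality forces A = Q.  A line of A sums to 1 and its nonzero entries are at least ¼, so it
-- has at most four of them.

open import Defs

module Hall where

  open import Data.Bool using (true; false)
  open import Data.Empty using (⊥; ⊥-elim)
  open import Data.Fin using (Fin; zero; suc; _≟_)
  open import Data.Fin.Properties using (any?)
  open import Data.Fin.Subset using (Subset; _∈_; _∉_; _⊆_; _∪_; _∩_; ∁; ⁅_⁆; ∣_∣; Nonempty)
  open import Data.Fin.Subset.Properties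
    using (_∈?_; nonempty?; Empty-unique; ∣⊥∣≡0; anySubset?; x∈⁅x⁆; x∈⁅y⁆⇒x≡y; ∣⁅x⁆∣≡1; x≢y⇒x∉⁅y⁆; x∉⁅y⁆⇒x≢y;
           x∈p∪q⁺; x∈p∪q⁻; x∈p∩q⁺; x∈p∩q⁻; x∉p⇒x∈∁p; x∈∁p⇒x∉p; p⊆p∪q; p⊆q⇒∣p∣≤∣q∣; p⊂q⇒∣p∣<∣q∣)
  open import Data.Nat using (ℕ; zero; suc; _+_; _≤_; _<_; _<?_; z≤n; s≤s)
  open import Data.Nat.Induction using (<-wellFounded)
  open import Data.Nat.Properties
    using (≤-trans; <-irrefl; ≮⇒≥; <⇒≱; +-mono-≤; +-mono-<-≤; +-mono-≤-<; +-monoʳ-<; +-suc; +-comm; n<1+n; m≤m+n;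
           +-0-monoid; module ≤-Reasoning)
  open import Algebra.Properties.Monoid.Sum +-0-monoid using (sum)
  open import Data.Product using (_×_; _,_; proj₁; proj₂; ∃-syntax)
  open import Data.Sum using (_⊎_; inj₁; inj₂; swap)
  open import Data.Vec using ([]; _∷_; tabulate)
  open import Data.Vec.Properties using (lookup∘tabulate; lookup⇒[]=; []=⇒lookup)
  open import Function using (_∘_)
  open import Function.Definitions using (Injective)
  open import Induction.WellFounded using (Acc; acc)
  open import Relation.Nullary using (Dec; yes; no; does; ¬_; contradiction)
  open import Relation.Nullary.Decidable using (dec-true; decidable-stable; ¬?; _×-dec_)
  open import Relation.Binary.PropositionalEquality using (_≡_; _≢_; refl; sym; trans; cong; subst)

  private variable m n : ℕ

  record Graph (m n : ℕ) : Set₁ where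
    field
      Edge  : Fin m → Fin n → Set
      edge? : ∀ i j → Dec (Edge i j)
  open Graph public

  _⊑_ : Graph m n → Graph m n → Set
  H ⊑ G = ∀ {i j} → Edge H i j → Edge G i j

  neighbours : Graph m n → Subset m → Subset n
  neighbours G X = tabulate λ j → does (any? λ i → i ∈? X ×-dec edge? G i j)

  ∈-neighbours⁺ : ∀ (G : Graph m n) {X i j} → i ∈ X → Edge G i j → j ∈ neighbours G X
  ∈-neighbours⁺ G {X} {i} {j} i∈X ij =
    lookup⇒[]= j (neighbours G X) (trans (lookup∘tabulate _ j) (dec-true (any? _) (i , i∈X , ij)))

  ∈-neighbours⁻ : ∀ (G : Graph m n) {X j} → j ∈ neighbours G X → ∃[ i ] i ∈ X × Edge G i j
  ∈-neighbours⁻ G {X} {j} j∈N = witness (any? _) (trans (sym (lookup∘tabulate _ j)) ([]=⇒lookup j∈N))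
    where
    witness : ∀ {A : Set} (a? : Dec A) → does a? ≡ true → A
    witness (yes a) _  = a
    witness (no _)  ()

  neighbours-mono : ∀ {H G : Graph m n} {X} → H ⊑ G → neighbours H X ⊆ neighbours G X
  neighbours-mono {H = H} {G} H⊑G j∈N with ∈-neighbours⁻ H j∈N
  ... | i , i∈X , ij = ∈-neighbours⁺ G i∈X (H⊑G ij)

  HallCondition : Graph m n → Set
  HallCondition {m} G = ∀ (X : Subset m) → ∣ X ∣ ≤ ∣ neighbours G X ∣

  record Matching (G : Graph m n) : Set where
    field
      match           : Fin m → Fin n
      match-edge      : ∀ i → Edge G i (match i)
      match-injective : Injective _≡_ _≡_ match

  matching-mono : ∀ {H G : Graph m n} → H ⊑ G → Matching H → Matching G
  matching-mono H⊑G M =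
    record { match = match ; match-edge = H⊑G ∘ match-edge ; match-injective = match-injective }
    where open Matching M

  deleteEdge : Graph m n → Fin m → Fin n → Graph m n
  deleteEdge G x y = record
    { Edge  = λ i j → Edge G i j × ¬ (i ≡ x × j ≡ y)
    ; edge? = λ i j → edge? G i j ×-dec ¬? (i ≟ x ×-dec j ≟ y)
    }

  deleteEdge-⊑ : ∀ (G : Graph m n) x y → deleteEdge G x y ⊑ G
  deleteEdge-⊑ G x y = proj₁

  ∣p∪q∣+∣p∩q∣≡∣p∣+∣q∣ : ∀ (p q : Subset n) → ∣ p ∪ q ∣ + ∣ p ∩ q ∣ ≡ ∣ p ∣ + ∣ q ∣
  ∣p∪q∣+∣p∩q∣≡∣p∣+∣q∣ []          []          = refl
  ∣p∪q∣+∣p∩q∣≡∣p∣+∣q∣ (true ∷ p)  (true ∷ q)  =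
    cong suc (trans (+-suc _ _) (trans (cong suc (∣p∪q∣+∣p∩q∣≡∣p∣+∣q∣ p q)) (sym (+-suc _ _))))
  ∣p∪q∣+∣p∩q∣≡∣p∣+∣q∣ (true ∷ p)  (false ∷ q) = cong suc (∣p∪q∣+∣p∩q∣≡∣p∣+∣q∣ p q)
  ∣p∪q∣+∣p∩q∣≡∣p∣+∣q∣ (false ∷ p) (true ∷ q)  = trans (cong suc (∣p∪q∣+∣p∩q∣≡∣p∣+∣q∣ p q)) (sym (+-suc _ _))
  ∣p∪q∣+∣p∩q∣≡∣p∣+∣q∣ (false ∷ p) (false ∷ q) = ∣p∪q∣+∣p∩q∣≡∣p∣+∣q∣ p q

  ∣p∪q∣≤∣p∣+∣q∣ : ∀ (p q : Subset n) → ∣ p ∪ q ∣ ≤ ∣ p ∣ + ∣ q ∣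
  ∣p∪q∣≤∣p∣+∣q∣ p q = subst (∣ p ∪ q ∣ ≤_) (∣p∪q∣+∣p∩q∣≡∣p∣+∣q∣ p q) (m≤m+n _ _)

  ∣p∣≤1+∣p∩∁⁅x⁆∣ : ∀ (p : Subset n) x → ∣ p ∣ ≤ suc ∣ p ∩ ∁ ⁅ x ⁆ ∣
  ∣p∣≤1+∣p∩∁⁅x⁆∣ p x = begin
    ∣ p ∣                          ≤⟨ p⊆q⇒∣p∣≤∣q∣ p⊆p-x∪x ⟩
    ∣ p ∩ ∁ ⁅ x ⁆ ∪ ⁅ x ⁆ ∣         ≤⟨ ∣p∪q∣≤∣p∣+∣q∣ (p ∩ ∁ ⁅ x ⁆) ⁅ x ⁆ ⟩
    ∣ p ∩ ∁ ⁅ x ⁆ ∣ + ∣ ⁅ x ⁆ ∣      ≡⟨ cong (∣ p ∩ ∁ ⁅ x ⁆ ∣ +_) (∣⁅x⁆∣≡1 x) ⟩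
    ∣ p ∩ ∁ ⁅ x ⁆ ∣ + 1             ≡⟨ +-comm _ 1 ⟩
    suc ∣ p ∩ ∁ ⁅ x ⁆ ∣             ∎
    where
    open ≤-Reasoning
    p⊆p-x∪x : p ⊆ p ∩ ∁ ⁅ x ⁆ ∪ ⁅ x ⁆
    p⊆p-x∪x {i} i∈p with i ≟ x
    ... | yes refl = x∈p∪q⁺ (inj₂ (x∈⁅x⁆ x))
    ... | no  i≢x  = x∈p∪q⁺ (inj₁ (x∈p∩q⁺ (i∈p , x∉p⇒x∈∁p (x≢y⇒x∉⁅y⁆ i≢x))))

  1≤∣p∣⇒nonempty : ∀ (p : Subset n) → 1 ≤ ∣ p ∣ → Nonempty p
  1≤∣p∣⇒nonempty {n} p 1≤∣p∣ with nonempty? p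
  ... | yes p≢∅ = p≢∅
  ... | no  p≡∅ = contradiction (subst (1 ≤_) (∣⊥∣≡0 n) (subst (λ q → 1 ≤ ∣ q ∣) (Empty-unique p≡∅) 1≤∣p∣)) λ ()

  degree : Graph m n → Fin m → ℕ
  degree G i = ∣ neighbours G ⁅ i ⁆ ∣

  edgeCount : Graph m n → ℕ
  edgeCount G = sum (degree G)

  sum-mono-≤ : ∀ {f g : Fin m → ℕ} → (∀ i → f i ≤ g i) → sum f ≤ sum g
  sum-mono-≤ {zero}  _   = z≤n
  sum-mono-≤ {suc m} f≤g = +-mono-≤ (f≤g zero) (sum-mono-≤ (f≤g ∘ suc))

  sum-mono-< : ∀ {f g : Fin m → ℕ} → (∀ i → f i ≤ g i) → ∀ k → f k < g k → sum f < sum g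
  sum-mono-< f≤g zero    fk<gk = +-mono-<-≤ fk<gk (sum-mono-≤ (f≤g ∘ suc))
  sum-mono-< f≤g (suc k) fk<gk = +-mono-≤-< (f≤g zero) (sum-mono-< (f≤g ∘ suc) k fk<gk)

  edgeCount-deleteEdge : ∀ (G : Graph m n) {x y} → Edge G x y → edgeCount (deleteEdge G x y) < edgeCount G
  edgeCount-deleteEdge G {x} {y} xy =
    sum-mono-< {f = degree (deleteEdge G x y)} {degree G} (λ _ → p⊆q⇒∣p∣≤∣q∣ N′⊆N) x
               (p⊂q⇒∣p∣<∣q∣ (N′⊆N , y , ∈-neighbours⁺ G (x∈⁅x⁆ x) xy , y∉N′))
    where
    N′⊆N : ∀ {X} → neighbours (deleteEdge G x y) X ⊆ neighbours G X
    N′⊆N = neighbours-mono {H = deleteEdge G x y} {G} (deleteEdge-⊑ G x y)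
    y∉N′ : y ∉ neighbours (deleteEdge G x y) ⁅ x ⁆
    y∉N′ y∈N′ with ∈-neighbours⁻ (deleteEdge G x y) y∈N′
    ... | i , i∈⁅x⁆ , (_ , iy≢xy) = iy≢xy (x∈⁅y⁆⇒x≡y x i∈⁅x⁆ , refl)

  Deficient : Graph m n → Subset m → Set
  Deficient G X = ∣ neighbours G X ∣ < ∣ X ∣

  module _ {G : Graph m n} (hallG : HallCondition G) {x : Fin m} where

    deficient-∋ : ∀ {y X} → Deficient (deleteEdge G x y) X → x ∈ X
    deficient-∋ {y} {X} deficient with x ∈? X
    ... | yes x∈X = x∈X
    ... | no  x∉X = contradiction (≤-trans (hallG X) (p⊆q⇒∣p∣≤∣q∣ N⊆N′)) (<⇒≱ deficient)
      where
      N⊆N′ : neighbours G X ⊆ neighbours (deleteEdge G x y) X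
      N⊆N′ j∈N with ∈-neighbours⁻ G j∈N
      ... | i , i∈X , ij = ∈-neighbours⁺ _ i∈X (ij , λ (i≡x , _) → x∉X (subst (_∈ X) i≡x i∈X))

    ∈-neighbours-deleteEdge : ∀ {y y′ X X′ i j} → y′ ≢ y → x ∈ X′ → i ∈ X → Edge G i j →
      j ∈ neighbours (deleteEdge G x y) X ⊎ j ∈ neighbours (deleteEdge G x y′) X′
    ∈-neighbours-deleteEdge {y} {y′} {i = i} {j} y′≢y x∈X′ i∈X ij with i ≟ x ×-dec j ≟ y
    ... | no  ij≢xy         = inj₁ (∈-neighbours⁺ _ i∈X (ij , ij≢xy))
    ... | yes (refl , refl) = inj₂ (∈-neighbours⁺ _ x∈X′ (ij , y′≢y ∘ sym ∘ proj₂))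

    rado : ∀ {y₁ y₂ X₁ X₂} → y₁ ≢ y₂ →
      Deficient (deleteEdge G x y₁) X₁ → Deficient (deleteEdge G x y₂) X₂ → ⊥
    rado {y₁} {y₂} {X₁} {X₂} y₁≢y₂ d₁ d₂ = <-irrefl refl (begin-strict
      ∣ X₁ ∣ + ∣ X₂ ∣                 ≡⟨ ∣p∪q∣+∣p∩q∣≡∣p∣+∣q∣ X₁ X₂ ⟨
      ∣ X₁ ∪ X₂ ∣ + ∣ X₁ ∩ X₂ ∣       ≤⟨ +-mono-≤ union intersection ⟩
      ∣ N₁ ∪ N₂ ∣ + suc ∣ N₁ ∩ N₂ ∣   ≡⟨ +-suc _ _ ⟩
      suc (∣ N₁ ∪ N₂ ∣ + ∣ N₁ ∩ N₂ ∣) ≡⟨ cong suc (∣p∪q∣+∣p∩q∣≡∣p∣+∣q∣ N₁ N₂) ⟩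
      suc (∣ N₁ ∣ + ∣ N₂ ∣)            <⟨ s≤s (+-monoʳ-< _ (n<1+n _)) ⟩
      suc ∣ N₁ ∣ + suc ∣ N₂ ∣          ≤⟨ +-mono-≤ d₁ d₂ ⟩
      ∣ X₁ ∣ + ∣ X₂ ∣                 ∎)
      where
      open ≤-Reasoning
      N₁ N₂ Z : Subset _
      N₁ = neighbours (deleteEdge G x y₁) X₁
      N₂ = neighbours (deleteEdge G x y₂) X₂
      Z  = (X₁ ∩ X₂) ∩ ∁ ⁅ x ⁆

      N∪⊆N₁∪N₂ : neighbours G (X₁ ∪ X₂) ⊆ N₁ ∪ N₂
      N∪⊆N₁∪N₂ j∈N with ∈-neighbours⁻ G j∈N
      ... | i , i∈X₁∪X₂ , ij with x∈p∪q⁻ X₁ X₂ i∈X₁∪X₂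
      ... | inj₁ i∈X₁ = x∈p∪q⁺ (∈-neighbours-deleteEdge (y₁≢y₂ ∘ sym) (deficient-∋ d₂) i∈X₁ ij)
      ... | inj₂ i∈X₂ = x∈p∪q⁺ (swap (∈-neighbours-deleteEdge y₁≢y₂ (deficient-∋ d₁) i∈X₂ ij))

      NZ⊆N₁∩N₂ : neighbours G Z ⊆ N₁ ∩ N₂
      NZ⊆N₁∩N₂ j∈N with ∈-neighbours⁻ G j∈N
      ... | i , i∈Z , ij with x∈p∩q⁻ (X₁ ∩ X₂) _ i∈Z
      ... | i∈X₁∩X₂ , i∉⁅x⁆ with x∈p∩q⁻ X₁ X₂ i∈X₁∩X₂
      ... | i∈X₁ , i∈X₂ = x∈p∩q⁺ (∈-neighbours⁺ _ i∈X₁ (ij , i≢x ∘ proj₁) , ∈-neighbours⁺ _ i∈X₂ (ij , i≢x ∘ proj₁))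
        where
        i≢x : i ≢ x
        i≢x = x∉⁅y⁆⇒x≢y (x∈∁p⇒x∉p i∉⁅x⁆)

      union : ∣ X₁ ∪ X₂ ∣ ≤ ∣ N₁ ∪ N₂ ∣
      union = ≤-trans (hallG (X₁ ∪ X₂)) (p⊆q⇒∣p∣≤∣q∣ N∪⊆N₁∪N₂)

      intersection : ∣ X₁ ∩ X₂ ∣ ≤ suc ∣ N₁ ∩ N₂ ∣
      intersection = ≤-trans (∣p∣≤1+∣p∩∁⁅x⁆∣ (X₁ ∩ X₂) x) (s≤s (≤-trans (hallG Z) (p⊆q⇒∣p∣≤∣q∣ NZ⊆N₁∩N₂)))

  hall-deleteEdge : ∀ {G : Graph m n} → HallCondition G →
    ∀ {x y₁ y₂} → y₁ ≢ y₂ → Edge G x y₁ → Edge G x y₂ → ∃[ y ] Edge G x y × HallCondition (deleteEdge G x y)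
  hall-deleteEdge {G = G} hallG {x} {y₁} {y₂} y₁≢y₂ e₁ e₂
    with anySubset? (λ X → ∣ neighbours (deleteEdge G x y₁) X ∣ <? ∣ X ∣)
       | anySubset? (λ X → ∣ neighbours (deleteEdge G x y₂) X ∣ <? ∣ X ∣)
  ... | no none₁      | _             = y₁ , e₁ , λ X → ≮⇒≥ (none₁ ∘ (X ,_))
  ... | yes _         | no none₂      = y₂ , e₂ , λ X → ≮⇒≥ (none₂ ∘ (X ,_))
  ... | yes (X₁ , d₁) | yes (X₂ , d₂) = ⊥-elim (rado hallG y₁≢y₂ d₁ d₂)

  uniqueNeighbours⇒matching : ∀ {G : Graph m n} → HallCondition G →
    (∀ {x y y′} → Edge G x y → Edge G x y′ → y ≡ y′) → Matching G
  uniqueNeighbours⇒matching {m} {n} {G} hallG unique = record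
    { match = match ; match-edge = proj₂ ∘ some-neighbour ; match-injective = injective }
    where
    some-neighbour : ∀ x → ∃[ y ] Edge G x y
    some-neighbour x
      with 1≤∣p∣⇒nonempty (neighbours G ⁅ x ⁆) (subst (_≤ ∣ neighbours G ⁅ x ⁆ ∣) (∣⁅x⁆∣≡1 x) (hallG ⁅ x ⁆))
    ... | y , y∈N with ∈-neighbours⁻ G y∈N
    ... | i , i∈⁅x⁆ , iy = y , subst (λ k → Edge G k y) (x∈⁅y⁆⇒x≡y x i∈⁅x⁆) iy

    match : Fin m → Fin n
    match = proj₁ ∘ some-neighbour

    injective : Injective _≡_ _≡_ match
    injective {x} {x′} fx≡fx′ with x ≟ x′
    ... | yes x≡x′ = x≡x′
    ... | no  x≢x′ = contradiction (hallG X) (<⇒≱ (begin-strict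
          ∣ neighbours G X ∣  ≤⟨ p⊆q⇒∣p∣≤∣q∣ N⊆⁅fx⁆ ⟩
          ∣ ⁅ match x ⁆ ∣     ≡⟨ ∣⁅x⁆∣≡1 (match x) ⟩
          1                  ≡⟨ ∣⁅x⁆∣≡1 x ⟨
          ∣ ⁅ x ⁆ ∣           <⟨ p⊂q⇒∣p∣<∣q∣ (p⊆p∪q ⁅ x′ ⁆ , x′ , x∈p∪q⁺ (inj₂ (x∈⁅x⁆ x′)) ,
                                                   x≢x′ ∘ sym ∘ x∈⁅y⁆⇒x≡y x) ⟩
          ∣ X ∣               ∎))
      where
      open ≤-Reasoning
      X = ⁅ x ⁆ ∪ ⁅ x′ ⁆
      N⊆⁅fx⁆ : neighbours G X ⊆ ⁅ match x ⁆
      N⊆⁅fx⁆ j∈N with ∈-neighbours⁻ G j∈N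
      ... | i , i∈X , ij =
        subst (_∈ ⁅ match x ⁆) (sym (trans (unique ij (proj₂ (some-neighbour i))) (match-i≡match-x (x∈p∪q⁻ _ _ i∈X))))
          (x∈⁅x⁆ (match x))
        where
        match-i≡match-x : i ∈ ⁅ x ⁆ ⊎ i ∈ ⁅ x′ ⁆ → match i ≡ match x
        match-i≡match-x (inj₁ i∈⁅x⁆)  = cong match (x∈⁅y⁆⇒x≡y x i∈⁅x⁆)
        match-i≡match-x (inj₂ i∈⁅x′⁆) = trans (cong match (x∈⁅y⁆⇒x≡y x′ i∈⁅x′⁆)) (sym fx≡fx′)

  hall : ∀ (G : Graph m n) → HallCondition G → Matching G
  hall G = go G (<-wellFounded (edgeCount G))
    where
    go : ∀ (G : Graph m n) → Acc _<_ (edgeCount G) → HallCondition G → Matching G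
    go G (acc smaller) hallG
      with any? (λ x → any? λ y₁ → any? λ y₂ → ¬? (y₁ ≟ y₂) ×-dec edge? G x y₁ ×-dec edge? G x y₂)
    ... | no none = uniqueNeighbours⇒matching hallG λ {x} {y} {y′} xy xy′ →
          decidable-stable (y ≟ y′) λ y≢y′ → none (x , y , y′ , y≢y′ , xy , xy′)
    ... | yes (x , y₁ , y₂ , y₁≢y₂ , e₁ , e₂) with hall-deleteEdge hallG y₁≢y₂ e₁ e₂
    ...   | y , xy , hall′ =
          matching-mono (deleteEdge-⊑ G x y) (go (deleteEdge G x y) (smaller (edgeCount-deleteEdge G xy)) hall′)

module ExtremePoints where

  open Hall using (Graph; HallCondition; Matching; module Matching; hall; neighbours; ∈-neighbours⁺)
  open import Algebra.Bundles using (CommutativeRing)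
  open import Data.Bool using (Bool; true; false; if_then_else_)
  open import Data.Fin as Fin using (Fin; zero; suc; opposite; punchOut)
  open import Data.Fin.Permutation using (reverse)
  open import Data.Fin.Properties using (any?; injective⇒≤; punchOut-injective; opposite-involutive)
  open import Data.Fin.Subset using (Subset; ∣_∣)
  open import Data.Nat as ℕ using (ℕ; zero; suc)
  import Data.Nat.Properties as ℕ
  open import Data.Product using (_×_; _,_; proj₁; proj₂; ∃-syntax)
  open import Data.Rational
    using (ℚ; 0ℚ; 1ℚ; ½; _+_; _*_; _-_; -_; _≤_; _<_; _⊓_; +-0-rawMonoid; nonNegative; positive; ≢-nonZero)
  open import Data.Rational.Properties
    using (_≟_; _≤?_; _<?_; ≤-refl; ≤-trans; ≤-reflexive; ≤-antisym; <⇒≤; <⇒≢; <-≤-trans; <-irrefl; module ≤-Reasoning;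
           +-mono-≤; +-monoˡ-≤; +-monoʳ-≤; +-monoʳ-<; +-mono-<-≤; +-identityˡ; +-identityʳ; +-inverseʳ;
           *-identityʳ; *-zeroˡ; *-zeroʳ; *-monoˡ-≤-nonNeg; *-cancelˡ-≤-pos; nonNeg*nonNeg⇒nonNeg; nonNeg∧nonZero⇒pos;
           nonNegative⁻¹; positive⁻¹; ⊓-sel; p⊓q≤p; p⊓q≤q; +-*-commutativeRing)
  open import Algebra.Definitions.RawMonoid +-0-rawMonoid using () renaming (_×_ to _·_)
  open import Data.Rational.Solver using (module +-*-Solver)
  open +-*-Solver using (solve; _:+_; _:*_; _:-_; :-_; _:=_; con)
  open import Data.Sum using (_⊎_; inj₁; inj₂)
  open import Data.Vec using ([]; _∷_; lookup)
  open import Data.Vec.Properties using (lookup⇒[]=; []=⇒lookup)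
  open import Function using (_∘_; mk⇔)
  open import Function.Definitions using (Injective)
  open import Relation.Nullary using (yes; no; does; contradiction)
  open import Relation.Nullary.Decidable using (from-yes; does-⇔; ¬?)
  open import Relation.Binary.PropositionalEquality
    using (_≡_; _≢_; refl; sym; trans; cong; cong₂; subst; module ≡-Reasoning)
  open import Algebra.Properties.Semiring.Sum (CommutativeRing.semiring +-*-commutativeRing)
    using (sum; sum-cong-≗; sum-replicate-zero; ∑-distrib-+; ∑-comm; *-distribˡ-sum; ∑-permute)

  private variable
    n k : ℕ
    f g : Fin n → ℚ

  0≤* : ∀ {p q} → 0ℚ ≤ p → 0ℚ ≤ q → 0ℚ ≤ p * q
  0≤* {p} {q} 0≤p 0≤q =
    nonNegative⁻¹ (p * q) {{nonNeg*nonNeg⇒nonNeg p {{nonNegative 0≤p}} q {{nonNegative 0≤q}}}}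

  0≤∧≢0⇒0< : ∀ {p} → 0ℚ ≤ p → p ≢ 0ℚ → 0ℚ < p
  0≤∧≢0⇒0< {p} 0≤p p≢0 = positive⁻¹ p {{nonNeg∧nonZero⇒pos p {{nonNegative 0≤p}} {{≢-nonZero p≢0}}}}

  0<⊓ : ∀ {p q} → 0ℚ < p → 0ℚ < q → 0ℚ < p ⊓ q
  0<⊓ {p} {q} 0<p 0<q with ⊓-sel p q
  ... | inj₁ p⊓q≡p = subst (0ℚ <_) (sym p⊓q≡p) 0<p
  ... | inj₂ p⊓q≡q = subst (0ℚ <_) (sym p⊓q≡q) 0<q

  p≤q⇒0≤q-p : ∀ {p q} → p ≤ q → 0ℚ ≤ q - p
  p≤q⇒0≤q-p {p} {q} p≤q = subst (_≤ q - p) (+-inverseʳ p) (+-monoˡ-≤ (- p) p≤q)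

  *-cancelˡ-≡-pos : ∀ {r p q} → 0ℚ < r → r * p ≡ r * q → p ≡ q
  *-cancelˡ-≡-pos {r} 0<r rp≡rq = ≤-antisym (*-cancelˡ-≤-pos r {{positive 0<r}} (≤-reflexive rp≡rq))
                                            (*-cancelˡ-≤-pos r {{positive 0<r}} (≤-reflexive (sym rp≡rq)))

  sumℚ≡sum : (f : Fin n → ℚ) → sumℚ f ≡ sum f
  sumℚ≡sum {zero}  f = refl
  sumℚ≡sum {suc n} f = cong (f zero +_) (sumℚ≡sum (f ∘ suc))

  sum-mono-≤ : (∀ i → f i ≤ g i) → sum f ≤ sum g
  sum-mono-≤ {zero}  _   = ≤-refl
  sum-mono-≤ {suc n} f≤g = +-mono-≤ (f≤g zero) (sum-mono-≤ (f≤g ∘ suc))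

  sum-nonneg : (∀ i → 0ℚ ≤ f i) → 0ℚ ≤ sum f
  sum-nonneg {n} {f} 0≤f = subst (_≤ sum f) (sum-replicate-zero n) (sum-mono-≤ {f = λ _ → 0ℚ} 0≤f)

  term≤sum : (∀ i → 0ℚ ≤ f i) → ∀ k → f k ≤ sum f
  term≤sum {f = f} 0≤f zero    =
    subst (_≤ sum f) (+-identityʳ (f zero)) (+-monoʳ-≤ (f zero) (sum-nonneg {f = f ∘ suc} (0≤f ∘ suc)))
  term≤sum {f = f} 0≤f (suc k) =
    ≤-trans (term≤sum (0≤f ∘ suc) k) (subst (_≤ sum f) (+-identityˡ _) (+-monoˡ-≤ (sum (f ∘ suc)) (0≤f zero)))

  sumℚ-opposite : (f : Fin n → ℚ) → sumℚ (f ∘ opposite) ≡ sumℚ f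
  sumℚ-opposite f =
    trans (sumℚ≡sum (f ∘ opposite)) (trans (sym (∑-permute f reverse)) (sym (sumℚ≡sum f)))

  sum-scaled : ∀ (f : Fin n → ℚ) → sum f ≡ 1ℚ → ∀ c → sum (λ i → c * f i) ≡ c
  sum-scaled f Σf≡1 c = begin
    sum (λ i → c * f i) ≡⟨ *-distribˡ-sum c f ⟨
    c * sum f           ≡⟨ cong (c *_) Σf≡1 ⟩
    c * 1ℚ              ≡⟨ *-identityʳ c ⟩
    c                   ∎
    where open ≡-Reasoning

  𝟙 : Bool → ℚ
  𝟙 b = if b then 1ℚ else 0ℚ

  0≤𝟙 : ∀ b → 0ℚ ≤ 𝟙 b
  0≤𝟙 true  = from-yes (0ℚ ≤? 1ℚ)
  0≤𝟙 false = ≤-refl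

  sum-𝟙-lookup : (X : Subset n) → sum (λ i → 𝟙 (lookup X i)) ≡ ∣ X ∣ · 1ℚ
  sum-𝟙-lookup []          = refl
  sum-𝟙-lookup (true ∷ X)  = cong (1ℚ +_) (sum-𝟙-lookup X)
  sum-𝟙-lookup (false ∷ X) = trans (+-identityˡ _) (sum-𝟙-lookup X)

  sum-𝟙-≟ : (k : Fin n) → sum (λ j → 𝟙 (does (k Fin.≟ j))) ≡ 1ℚ
  sum-𝟙-≟ {suc n} zero    = trans (cong (1ℚ +_) (sum-replicate-zero n)) (+-identityʳ 1ℚ)
  sum-𝟙-≟ {suc n} (suc k) = trans (+-identityˡ _) (sum-𝟙-≟ k)

  𝟙*-mono : ∀ {x y a} → 0ℚ ≤ a → (x ≡ true → a ≢ 0ℚ → y ≡ true) → 𝟙 x * a ≤ 𝟙 y * a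
  𝟙*-mono {false} {y} {a} 0≤a _ = subst (_≤ 𝟙 y * a) (sym (*-zeroˡ a)) (0≤* (0≤𝟙 y) 0≤a)
  𝟙*-mono {true}  {true}      _ _ = ≤-refl
  𝟙*-mono {true}  {false} {a} _ x⇒y with a ≟ 0ℚ
  ... | yes refl = ≤-refl
  ... | no  a≢0  = contradiction (x⇒y refl a≢0) λ ()

  ·-nonneg : ∀ {ε} → 0ℚ ≤ ε → ∀ k → 0ℚ ≤ k · ε
  ·-nonneg 0≤ε zero    = ≤-refl
  ·-nonneg 0≤ε (suc k) = +-mono-≤ 0≤ε (·-nonneg 0≤ε k)

  ·-monoˡ-< : ∀ {ε k l} → 0ℚ < ε → k ℕ.< l → k · ε < l · ε
  ·-monoˡ-< {k = zero}  {suc l} 0<ε _              = +-mono-<-≤ 0<ε (·-nonneg (<⇒≤ 0<ε) l)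
  ·-monoˡ-< {ε} {suc k} {suc l} 0<ε (ℕ.s≤s k<l) = +-monoʳ-< ε (·-monoˡ-< 0<ε k<l)

  ·-cancelʳ-≤ : ∀ {ε k l} → 0ℚ < ε → k · ε ≤ l · ε → k ℕ.≤ l
  ·-cancelʳ-≤ 0<ε kε≤lε = ℕ.≮⇒≥ λ l<k → <-irrefl refl (<-≤-trans (·-monoˡ-< 0<ε l<k) kε≤lε)

  InQuarters : ℚ → Set
  InQuarters q = q ≡ 0ℚ ⊎ q ≡ ¼ ⊎ q ≡ ½ ⊎ q ≡ ¾ ⊎ q ≡ 1ℚ

  inQuarters⇒≡0⊎¼≤ : ∀ {q} → InQuarters q → q ≡ 0ℚ ⊎ ¼ ≤ q
  inQuarters⇒≡0⊎¼≤ (inj₁ q≡0)                         = inj₁ q≡0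
  inQuarters⇒≡0⊎¼≤ (inj₂ (inj₁ refl))                 = inj₂ (from-yes (¼ ≤? ¼))
  inQuarters⇒≡0⊎¼≤ (inj₂ (inj₂ (inj₁ refl)))          = inj₂ (from-yes (¼ ≤? ½))
  inQuarters⇒≡0⊎¼≤ (inj₂ (inj₂ (inj₂ (inj₁ refl))))   = inj₂ (from-yes (¼ ≤? ¾))
  inQuarters⇒≡0⊎¼≤ (inj₂ (inj₂ (inj₂ (inj₂ refl))))   = inj₂ (from-yes (¼ ≤? 1ℚ))

  countNonzero-·-≤-sumℚ : ∀ {ε} (f : Fin n → ℚ) → (∀ i → f i ≡ 0ℚ ⊎ ε ≤ f i) →
    countNonzero f · ε ≤ sumℚ f
  countNonzero-·-≤-sumℚ {zero}  f _ = ≤-refl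
  countNonzero-·-≤-sumℚ {suc n} f zero⊎ε≤ with f zero ≟ 0ℚ | zero⊎ε≤ zero
  ... | yes f0≡0 | _         = ≤-trans (countNonzero-·-≤-sumℚ (f ∘ suc) (zero⊎ε≤ ∘ suc))
                                 (≤-reflexive (sym (trans (cong (_+ sumℚ (f ∘ suc)) f0≡0) (+-identityˡ _))))
  ... | no  f0≢0 | inj₁ f0≡0 = contradiction f0≡0 f0≢0
  ... | no  _    | inj₂ ε≤f0 = +-mono-≤ ε≤f0 (countNonzero-·-≤-sumℚ (f ∘ suc) (zero⊎ε≤ ∘ suc))

  countNonzero≤4 : (f : Fin n → ℚ) → (∀ i → InQuarters (f i)) → sumℚ f ≡ 1ℚ → countNonzero f ℕ.≤ 4
  countNonzero≤4 f quarters Σf≡1 = ·-cancelʳ-≤ (from-yes (0ℚ <? ¼))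
    (≤-trans (countNonzero-·-≤-sumℚ f (inQuarters⇒≡0⊎¼≤ ∘ quarters)) (≤-reflexive Σf≡1))

  support : Matrix n → Graph n n
  support A = record { Edge = λ i j → A i j ≢ 0ℚ ; edge? = λ i j → ¬? (A i j ≟ 0ℚ) }

  support-hall : ∀ {A : Matrix n} → IsDoublyStochastic A → HallCondition (support A)
  support-hall {n} {A} (0≤A , rows , cols) X = ·-cancelʳ-≤ (from-yes (0ℚ <? 1ℚ)) (begin
    ∣ X ∣ · 1ℚ                                     ≡⟨ sum-𝟙-lookup X ⟨
    sum (λ i → 𝟙 (lookup X i))                     ≡⟨ sum-cong-≗ (λ i → sum-scaled (A i) (row i) _) ⟨
    sum (λ i → sum (λ j → 𝟙 (lookup X i) * A i j)) ≤⟨ sum-mono-≤ (λ i → sum-mono-≤ (λ j → 𝟙*-mono (0≤A i j) (X→N i j))) ⟩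
    sum (λ i → sum (λ j → 𝟙 (lookup N j) * A i j)) ≡⟨ ∑-comm (λ i j → 𝟙 (lookup N j) * A i j) ⟩
    sum (λ j → sum (λ i → 𝟙 (lookup N j) * A i j)) ≡⟨ sum-cong-≗ (λ j → sum-scaled (λ i → A i j) (col j) _) ⟩
    sum (λ j → 𝟙 (lookup N j))                     ≡⟨ sum-𝟙-lookup N ⟩
    ∣ N ∣ · 1ℚ                                     ∎)
    where
    open ≤-Reasoning
    N : Subset n
    N = neighbours (support A) X
    row : ∀ i → sum (A i) ≡ 1ℚ
    row i = trans (sym (sumℚ≡sum (A i))) (rows i)
    col : ∀ j → sum (λ i → A i j) ≡ 1ℚ
    col j = trans (sym (sumℚ≡sum (λ i → A i j))) (cols j)
    X→N : ∀ i j → lookup X i ≡ true → A i j ≢ 0ℚ → lookup N j ≡ true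
    X→N i j i∈X Aij≢0 = []=⇒lookup (∈-neighbours⁺ (support A) (lookup⇒[]= i X i∈X) Aij≢0)

  injective⇒surjective : ∀ {π : Fin n → Fin n} → Injective _≡_ _≡_ π → ∀ j → ∃[ i ] π i ≡ j
  injective⇒surjective {suc n} {π} π-injective j with any? (λ i → π i Fin.≟ j)
  ... | yes hit  = hit
  ... | no  miss = contradiction (injective⇒≤ squeeze-injective) ℕ.1+n≰n
    where
    j≢π : ∀ i → j ≢ π i
    j≢π i = miss ∘ (i ,_) ∘ sym
    squeeze : Fin (suc n) → Fin n
    squeeze i = punchOut (j≢π i)
    squeeze-injective : Injective _≡_ _≡_ squeeze
    squeeze-injective {i} {i′} eq = π-injective (punchOut-injective (j≢π i) (j≢π i′) eq)

  permutationMatrix : (Fin n → Fin n) → Matrix n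
  permutationMatrix π i j = 𝟙 (does (π i Fin.≟ j))

  permutationMatrix-isDoublyStochastic : ∀ {π : Fin n → Fin n} → Injective _≡_ _≡_ π →
    IsDoublyStochastic (permutationMatrix π)
  permutationMatrix-isDoublyStochastic {π = π} π-injective = (λ i j → 0≤𝟙 _) , rows , cols
    where
    rows : ∀ i → sumℚ (permutationMatrix π i) ≡ 1ℚ
    rows i = trans (sumℚ≡sum (permutationMatrix π i)) (sum-𝟙-≟ (π i))
    cols : ∀ j → sumℚ (λ i → permutationMatrix π i j) ≡ 1ℚ
    cols j with injective⇒surjective π-injective j
    ... | i₀ , πi₀≡j = begin
      sumℚ (λ i → permutationMatrix π i j) ≡⟨ sumℚ≡sum (λ i → permutationMatrix π i j) ⟩
      sum (λ i → permutationMatrix π i j)  ≡⟨ sum-cong-≗ πi≡j⇔i₀≡i ⟩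
      sum (λ i → 𝟙 (does (i₀ Fin.≟ i)))    ≡⟨ sum-𝟙-≟ i₀ ⟩
      1ℚ                                   ∎
      where
      open ≡-Reasoning
      πi≡j⇔i₀≡i : ∀ i → permutationMatrix π i j ≡ 𝟙 (does (i₀ Fin.≟ i))
      πi≡j⇔i₀≡i i = cong 𝟙 (does-⇔ (mk⇔ (λ πi≡j → π-injective (trans πi₀≡j (sym πi≡j))) λ { refl → πi₀≡j })
                                   (π i Fin.≟ j) (i₀ Fin.≟ i))

  transpose-isDoublyStochastic : ∀ {P : Matrix n} → IsDoublyStochastic P → IsDoublyStochastic (transpose P)
  transpose-isDoublyStochastic (0≤P , rows , cols) = (λ i j → 0≤P j i) , cols , rows

  hankelTranspose-isDoublyStochastic : ∀ {P : Matrix n} → IsDoublyStochastic P →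
    IsDoublyStochastic (hankelTranspose P)
  hankelTranspose-isDoublyStochastic {P = P} (0≤P , rows , cols) =
    (λ i j → 0≤P _ _) ,
    (λ i → trans (sumℚ-opposite (λ k → P k (opposite i))) (cols (opposite i))) ,
    (λ j → trans (sumℚ-opposite (P (opposite j))) (rows (opposite j)))

  sum-average₄ : ∀ (f₁ f₂ f₃ f₄ : Fin n → ℚ) →
    sumℚ f₁ ≡ 1ℚ → sumℚ f₂ ≡ 1ℚ → sumℚ f₃ ≡ 1ℚ → sumℚ f₄ ≡ 1ℚ → sumℚ (λ k → ¼ * (f₁ k + f₂ k + f₃ k + f₄ k)) ≡ 1ℚ
  sum-average₄ f₁ f₂ f₃ f₄ Σ₁ Σ₂ Σ₃ Σ₄ = begin
    sumℚ (λ k → ¼ * (f₁ k + f₂ k + f₃ k + f₄ k))   ≡⟨ sumℚ≡sum (λ k → ¼ * (f₁ k + f₂ k + f₃ k + f₄ k)) ⟩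
    sum (λ k → ¼ * (f₁ k + f₂ k + f₃ k + f₄ k))    ≡⟨ *-distribˡ-sum ¼ (λ k → f₁ k + f₂ k + f₃ k + f₄ k) ⟨
    ¼ * sum (λ k → f₁ k + f₂ k + f₃ k + f₄ k)      ≡⟨ cong (¼ *_) sum-+₄ ⟩
    ¼ * (sum f₁ + sum f₂ + sum f₃ + sum f₄)        ≡⟨ cong (¼ *_) (cong₂ _+_ (cong₂ _+_ (cong₂ _+_ (Σ f₁ Σ₁) (Σ f₂ Σ₂))
                                                                             (Σ f₃ Σ₃)) (Σ f₄ Σ₄)) ⟩
    ¼ * (1ℚ + 1ℚ + 1ℚ + 1ℚ)                       ≡⟨⟩
    1ℚ                                            ∎
    where
    open ≡-Reasoning
    Σ : ∀ f → sumℚ f ≡ 1ℚ → sum f ≡ 1ℚ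
    Σ f Σf≡1 = trans (sym (sumℚ≡sum f)) Σf≡1
    sum-+₄ : sum (λ k → f₁ k + f₂ k + f₃ k + f₄ k) ≡ sum f₁ + sum f₂ + sum f₃ + sum f₄
    sum-+₄ = trans (∑-distrib-+ _ f₄)
                   (cong (_+ sum f₄) (trans (∑-distrib-+ _ f₃) (cong (_+ sum f₃) (∑-distrib-+ f₁ f₂))))

  average₄-isDoublyStochastic : ∀ {P₁ P₂ P₃ P₄ : Matrix n} →
    IsDoublyStochastic P₁ → IsDoublyStochastic P₂ → IsDoublyStochastic P₃ → IsDoublyStochastic P₄ →
    IsDoublyStochastic (λ i j → ¼ * (P₁ i j + P₂ i j + P₃ i j + P₄ i j))
  average₄-isDoublyStochastic {P₁ = P₁} {P₂} {P₃} {P₄}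
    (0≤P₁ , rows₁ , cols₁) (0≤P₂ , rows₂ , cols₂) (0≤P₃ , rows₃ , cols₃) (0≤P₄ , rows₄ , cols₄) =
    (λ i j → 0≤* (from-yes (0ℚ ≤? ¼)) (+-mono-≤ (+-mono-≤ (+-mono-≤ (0≤P₁ i j) (0≤P₂ i j)) (0≤P₃ i j)) (0≤P₄ i j))) ,
    (λ i → sum-average₄ (P₁ i) (P₂ i) (P₃ i) (P₄ i) (rows₁ i) (rows₂ i) (rows₃ i) (rows₄ i)) ,
    (λ j → sum-average₄ (λ i → P₁ i j) (λ i → P₂ i j) (λ i → P₃ i j) (λ i → P₄ i j)
                        (cols₁ j) (cols₂ j) (cols₃ j) (cols₄ j))

  symmetrize : Matrix n → Matrix n
  symmetrize P i j = ¼ * (P i j + transpose P i j + hankelTranspose P i j + hankelTranspose (transpose P) i j)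

  symmetrize-isDoublyStochastic : ∀ {P : Matrix n} → IsDoublyStochastic P → IsDoublyStochastic (symmetrize P)
  symmetrize-isDoublyStochastic {P = P} P-ds =
    average₄-isDoublyStochastic P-ds Pᵗ-ds (hankelTranspose-isDoublyStochastic P-ds)
                                           (hankelTranspose-isDoublyStochastic Pᵗ-ds)
    where
    Pᵗ-ds : IsDoublyStochastic (transpose P)
    Pᵗ-ds = transpose-isDoublyStochastic P-ds

  symmetrize-isSymmetric : (P : Matrix n) → IsSymmetric (symmetrize P)
  symmetrize-isSymmetric P i j =
    cong (¼ *_) (swap₁₂-swap₃₄ (P i j) (P j i) (P (opposite j) (opposite i)) (P (opposite i) (opposite j)))
    where
    swap₁₂-swap₃₄ : ∀ a b c d → b + a + d + c ≡ a + b + c + d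
    swap₁₂-swap₃₄ = solve 4 (λ a b c d → b :+ a :+ d :+ c := a :+ b :+ c :+ d) refl

  symmetrize-isHankelSymmetric : (P : Matrix n) → IsHankelSymmetric (symmetrize P)
  symmetrize-isHankelSymmetric P i j = cong (¼ *_) (begin
    c + d + P (opposite (opposite i)) (opposite (opposite j)) + P (opposite (opposite j)) (opposite (opposite i))
      ≡⟨ cong₂ (λ x y → c + d + x + y) (cong₂ P (opposite-involutive i) (opposite-involutive j))
                                       (cong₂ P (opposite-involutive j) (opposite-involutive i)) ⟩
    c + d + a + b
      ≡⟨ solve 4 (λ a b c d → c :+ d :+ a :+ b := a :+ b :+ c :+ d) refl a b c d ⟩
    a + b + c + d ∎)
    where
    open ≡-Reasoning
    a b c d : ℚ
    a = P i j
    b = P j i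
    c = P (opposite j) (opposite i)
    d = P (opposite i) (opposite j)

  symmetrize-InΩth : ∀ {P : Matrix n} → IsDoublyStochastic P → InΩth (symmetrize P)
  symmetrize-InΩth {P = P} P-ds =
    symmetrize-isDoublyStochastic P-ds , symmetrize-isSymmetric P , symmetrize-isHankelSymmetric P

  symmetrize-support : ∀ {A P : Matrix n} → IsSymmetric A → IsHankelSymmetric A →
    (∀ i j → A i j ≡ 0ℚ → P i j ≡ 0ℚ) → ∀ i j → A i j ≡ 0ℚ → symmetrize P i j ≡ 0ℚ
  symmetrize-support {A = A} {P} symA hankA P⊆A i j Aij≡0 = cong (¼ *_)
    (cong₂ _+_ (cong₂ _+_ (cong₂ _+_ (zero-at refl) (zero-at (symA i j))) (zero-at (hankA i j)))
               (zero-at (trans (hankA j i) (symA i j))))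
    where
    zero-at : ∀ {k l} → A k l ≡ A i j → P k l ≡ 0ℚ
    zero-at Akl≡Aij = P⊆A _ _ (trans Akl≡Aij Aij≡0)

  inQuarters-𝟙 : ∀ a b c d → InQuarters (¼ * (𝟙 a + 𝟙 b + 𝟙 c + 𝟙 d))
  inQuarters-𝟙 false false false false = inj₁ refl
  inQuarters-𝟙 false false false true  = inj₂ (inj₁ refl)
  inQuarters-𝟙 false false true  false = inj₂ (inj₁ refl)
  inQuarters-𝟙 false true  false false = inj₂ (inj₁ refl)
  inQuarters-𝟙 true  false false false = inj₂ (inj₁ refl)
  inQuarters-𝟙 false false true  true  = inj₂ (inj₂ (inj₁ refl))
  inQuarters-𝟙 false true  false true  = inj₂ (inj₂ (inj₁ refl))
  inQuarters-𝟙 false true  true  false = inj₂ (inj₂ (inj₁ refl))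
  inQuarters-𝟙 true  false false true  = inj₂ (inj₂ (inj₁ refl))
  inQuarters-𝟙 true  false true  false = inj₂ (inj₂ (inj₁ refl))
  inQuarters-𝟙 true  true  false false = inj₂ (inj₂ (inj₁ refl))
  inQuarters-𝟙 false true  true  true  = inj₂ (inj₂ (inj₂ (inj₁ refl)))
  inQuarters-𝟙 true  false true  true  = inj₂ (inj₂ (inj₂ (inj₁ refl)))
  inQuarters-𝟙 true  true  false true  = inj₂ (inj₂ (inj₂ (inj₁ refl)))
  inQuarters-𝟙 true  true  true  false = inj₂ (inj₂ (inj₂ (inj₁ refl)))
  inQuarters-𝟙 true  true  true  true  = inj₂ (inj₂ (inj₂ (inj₂ refl)))

  symmetrize-permutationMatrix-inQuarters : ∀ (π : Fin n → Fin n) i j →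
    InQuarters (symmetrize (permutationMatrix π) i j)
  symmetrize-permutationMatrix-inQuarters π i j = inQuarters-𝟙 (does (π i Fin.≟ j)) (does (π j Fin.≟ i))
    (does (π (opposite j) Fin.≟ opposite i)) (does (π (opposite i) Fin.≟ opposite j))

  l*b+[1-l]*c≡c⇒b≡c : ∀ {l b c} → 0ℚ < l → l * b + (1ℚ - l) * c ≡ c → b ≡ c
  l*b+[1-l]*c≡c⇒b≡c {l} {b} {c} 0<l combination≡c = *-cancelˡ-≡-pos 0<l (begin
    l * b
      ≡⟨ solve 3 (λ l b c → l :* b := (l :* b :+ (con 1ℚ :- l) :* c) :- (con 1ℚ :- l) :* c) refl l b c ⟩
    (l * b + (1ℚ - l) * c) - (1ℚ - l) * c
      ≡⟨ cong (_- (1ℚ - l) * c) combination≡c ⟩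
    c - (1ℚ - l) * c
      ≡⟨ solve 2 (λ l c → c :- (con 1ℚ :- l) :* c := l :* c) refl l c ⟩
    l * c ∎)
    where open ≡-Reasoning

  sum-convComb : ∀ l (f g : Fin n → ℚ) → sumℚ f ≡ 1ℚ → sumℚ g ≡ 1ℚ →
    sumℚ (λ k → l * f k + (1ℚ - l) * g k) ≡ 1ℚ
  sum-convComb l f g Σf≡1 Σg≡1 = begin
    sumℚ (λ k → l * f k + (1ℚ - l) * g k)            ≡⟨ sumℚ≡sum (λ k → l * f k + (1ℚ - l) * g k) ⟩
    sum (λ k → l * f k + (1ℚ - l) * g k)             ≡⟨ ∑-distrib-+ (λ k → l * f k) (λ k → (1ℚ - l) * g k) ⟩
    sum (λ k → l * f k) + sum (λ k → (1ℚ - l) * g k) ≡⟨ cong₂ _+_ (sum-scaled f (trans (sym (sumℚ≡sum f)) Σf≡1) l)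
                                                                  (sum-scaled g (trans (sym (sumℚ≡sum g)) Σg≡1) (1ℚ - l)) ⟩
    l + (1ℚ - l)                                     ≡⟨ solve 1 (λ l → l :+ (con 1ℚ :- l) := con 1ℚ) refl l ⟩
    1ℚ                                               ∎
    where open ≡-Reasoning

  convComb-InΩth : ∀ {B C : Matrix n} l → InΩth B → InΩth C → (∀ i j → 0ℚ ≤ convComb l B C i j) →
    InΩth (convComb l B C)
  convComb-InΩth {B = B} {C} l ((_ , rowsB , colsB) , symB , hankB) ((_ , rowsC , colsC) , symC , hankC) 0≤BC =
    (0≤BC , (λ i → sum-convComb l (B i) (C i) (rowsB i) (rowsC i)) ,
            (λ j → sum-convComb l (λ i → B i j) (λ i → C i j) (colsB j) (colsC j))) ,
    (λ i j → cong₂ (λ b c → l * b + (1ℚ - l) * c) (symB i j) (symC i j)) ,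
    (λ i j → cong₂ (λ b c → l * b + (1ℚ - l) * c) (hankB i j) (hankC i j))

  lowerBound-nonzero : (f : Fin k → ℚ) → (∀ i → 0ℚ ≤ f i) →
    ∃[ δ ] 0ℚ < δ × δ ≤ 1ℚ × (∀ i → f i ≢ 0ℚ → δ ≤ f i)
  lowerBound-nonzero {zero}  f _   = 1ℚ , from-yes (0ℚ <? 1ℚ) , ≤-refl , λ ()
  lowerBound-nonzero {suc k} f 0≤f with lowerBound-nonzero (f ∘ suc) (0≤f ∘ suc) | f zero ≟ 0ℚ
  ... | δ , 0<δ , δ≤1 , δ≤f | yes f0≡0 =
    δ , 0<δ , δ≤1 , λ { zero f0≢0 → contradiction f0≡0 f0≢0 ; (suc i) → δ≤f i }
  ... | δ , 0<δ , δ≤1 , δ≤f | no  f0≢0 =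
    f zero ⊓ δ , 0<⊓ (0≤∧≢0⇒0< (0≤f zero) f0≢0) 0<δ , ≤-trans (p⊓q≤q (f zero) δ) δ≤1 ,
    λ { zero _ → p⊓q≤p (f zero) δ ; (suc i) fi≢0 → ≤-trans (p⊓q≤q (f zero) δ) (δ≤f i fi≢0) }

  lowerBound-nonzero-matrix : (A : Matrix n) → (∀ i j → 0ℚ ≤ A i j) →
    ∃[ δ ] 0ℚ < δ × δ ≤ 1ℚ × (∀ i j → A i j ≢ 0ℚ → δ ≤ A i j)
  lowerBound-nonzero-matrix {n} A 0≤A =
    let δ , 0<δ , δ≤1 , δ≤δᵢ = lowerBound-nonzero δᵢ (λ i → <⇒≤ (0<δᵢ i))
    in  δ , 0<δ , δ≤1 , λ i j Aij≢0 → ≤-trans (δ≤δᵢ i (λ δᵢ≡0 → <⇒≢ (0<δᵢ i) (sym δᵢ≡0))) (δᵢ≤A i j Aij≢0)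
    where
    rowBound : ∀ i → ∃[ δ ] 0ℚ < δ × δ ≤ 1ℚ × (∀ j → A i j ≢ 0ℚ → δ ≤ A i j)
    rowBound i = lowerBound-nonzero (A i) (0≤A i)
    δᵢ : Fin n → ℚ
    δᵢ = proj₁ ∘ rowBound
    0<δᵢ : ∀ i → 0ℚ < δᵢ i
    0<δᵢ = proj₁ ∘ proj₂ ∘ rowBound
    δᵢ≤A : ∀ i j → A i j ≢ 0ℚ → δᵢ i ≤ A i j
    δᵢ≤A = proj₂ ∘ proj₂ ∘ proj₂ ∘ rowBound

  entry≤1 : ∀ {A : Matrix n} → IsDoublyStochastic A → ∀ i j → A i j ≤ 1ℚ
  entry≤1 {A = A} (0≤A , rows , _) i j =
    ≤-trans (term≤sum (0≤A i) j) (≤-reflexive (trans (sym (sumℚ≡sum (A i))) (rows i)))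

  extremePoint-support⊆⇒≡ : ∀ {A Q : Matrix n} → IsExtremePointΩth A → InΩth Q →
    (∀ i j → A i j ≡ 0ℚ → Q i j ≡ 0ℚ) → ∀ i j → Q i j ≡ A i j
  extremePoint-support⊆⇒≡ {n} {A} {Q} (A∈Ω@((0≤A , _) , _) , extreme) Q∈Ω@((Q-ds@(0≤Q , _) , _)) Q⊆A
    with lowerBound-nonzero-matrix A 0≤A
  ... | δ , 0<δ , δ≤1 , δ≤A = λ i j → l*b+[1-l]*c≡c⇒b≡c 0<δ (B≡A i j)
    where
    B C : Matrix n
    B = convComb δ Q A
    C = convComb (- δ) Q A

    0≤B : ∀ i j → 0ℚ ≤ B i j
    0≤B i j = +-mono-≤ (0≤* (<⇒≤ 0<δ) (0≤Q i j)) (0≤* (p≤q⇒0≤q-p δ≤1) (0≤A i j))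

    0≤C : ∀ i j → 0ℚ ≤ C i j
    0≤C i j with A i j ≟ 0ℚ
    ... | yes Aij≡0 = ≤-reflexive (sym (begin
      (- δ) * Q i j + (1ℚ - - δ) * A i j ≡⟨ cong₂ (λ q a → (- δ) * q + (1ℚ - - δ) * a) (Q⊆A i j Aij≡0) Aij≡0 ⟩
      (- δ) * 0ℚ + (1ℚ - - δ) * 0ℚ       ≡⟨ cong₂ _+_ (*-zeroʳ (- δ)) (*-zeroʳ (1ℚ - - δ)) ⟩
      0ℚ                                  ∎))
      where open ≡-Reasoning
    ... | no  Aij≢0 = subst (0ℚ ≤_) (sym (rearrange δ (Q i j) (A i j)))
                            (+-mono-≤ (p≤q⇒0≤q-p δQ≤A) (0≤* (<⇒≤ 0<δ) (0≤A i j)))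
      where
      rearrange : ∀ d q a → (- d) * q + (1ℚ - - d) * a ≡ (a - d * q) + d * a
      rearrange = solve 3 (λ d q a → (:- d) :* q :+ (con 1ℚ :- :- d) :* a := (a :- d :* q) :+ d :* a) refl
      δQ≤A : δ * Q i j ≤ A i j
      δQ≤A = ≤-trans (*-monoˡ-≤-nonNeg δ {{nonNegative (<⇒≤ 0<δ)}} (entry≤1 Q-ds i j))
                     (≤-trans (≤-reflexive (*-identityʳ δ)) (δ≤A i j Aij≢0))

    A≡midpoint : ∀ i j → A i j ≡ convComb ½ B C i j
    A≡midpoint i j = solve 3 (λ d q a → a := con ½ :* (d :* q :+ (con 1ℚ :- d) :* a)
                                              :+ (con 1ℚ :- con ½) :* ((:- d) :* q :+ (con 1ℚ :- :- d) :* a))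
                             refl δ (Q i j) (A i j)

    B≡A : ∀ i j → B i j ≡ A i j
    B≡A = proj₁ (extreme B C ½ (convComb-InΩth δ Q∈Ω A∈Ω 0≤B) (convComb-InΩth (- δ) Q∈Ω A∈Ω 0≤C)
                         (from-yes (0ℚ <? ½)) (from-yes (½ <? 1ℚ)) A≡midpoint)

  extremePoint≡symmetrize : ∀ {A : Matrix n} → IsExtremePointΩth A → (M : Matching (support A)) →
    ∀ i j → A i j ≡ symmetrize (permutationMatrix (Matching.match M)) i j
  extremePoint≡symmetrize {n} {A} ext@((A-ds , symA , hankA) , _) M i j =
    sym (extremePoint-support⊆⇒≡ {Q = symmetrize P} ext
          (symmetrize-InΩth {P = P} (permutationMatrix-isDoublyStochastic π-injective))
          (symmetrize-support {A = A} {P} symA hankA P⊆A) i j)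
    where
    open Matching M renaming (match to π; match-edge to π-edge; match-injective to π-injective)
    P : Matrix n
    P = permutationMatrix π
    P⊆A : ∀ i j → A i j ≡ 0ℚ → P i j ≡ 0ℚ
    P⊆A i j Aij≡0 with π i Fin.≟ j
    ... | yes refl = contradiction Aij≡0 (π-edge i)
    ... | no  _    = refl

  extremePoint-inQuarters : ∀ {A : Matrix n} → IsExtremePointΩth A → ∀ i j → InQuarters (A i j)
  extremePoint-inQuarters {A = A} ext@((A-ds , _) , _) i j =
    subst InQuarters (sym (extremePoint≡symmetrize ext M i j))
                     (symmetrize-permutationMatrix-inQuarters (Matching.match M) i j)
    where
    M : Matching (support A)
    M = hall (support A) (support-hall A-ds)

open import Data.Nat using (ℕ; _≤_)
open import Data.Fin using (Fin)
open import Data.Rational using (ℚ; 0ℚ; 1ℚ; ½)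
open import Data.Product using (_×_; _,_)
open import Data.Sum using (_⊎_)
open import Relation.Binary.PropositionalEquality using (_≡_)
open ExtremePoints using (InQuarters; extremePoint-inQuarters; countNonzero≤4)

corollary3p6 : (n : ℕ) (A : Matrix n) → IsExtremePointΩth A →
    (∀ i j → A i j ≡ 0ℚ ⊎ A i j ≡ ¼ ⊎ A i j ≡ ½ ⊎ A i j ≡ ¾ ⊎ A i j ≡ 1ℚ)
    × (∀ i → countNonzero (λ j → A i j) ≤ 4)
    × (∀ j → countNonzero (λ i → A i j) ≤ 4)
corollary3p6 n A ext@(((_ , rows , cols) , _) , _) =
  quarters ,
  (λ i → countNonzero≤4 (λ j → A i j) (quarters i) (rows i)) ,
  (λ j → countNonzero≤4 (λ i → A i j) (λ i → quarters i j) (cols j))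
  where
  quarters : ∀ i j → InQuarters (A i j)
  quarters = extremePoint-inQuarters ext
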